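{- Let $S\ge3$ be odd, and consider the process with $G^{(0)}=G_S$, thresholds $\alpha=\beta=2$, energy $\mathcal{E}^{(t)}(u,v)=|N_{G^{(t)}}(u)\cap N_{G^{(t)}}(v)|$, and interaction set $C^{(t)}$ consisting of all pairs of distinct vertices at distance at most $2$ in $G^{(t)}$. Then for every $t\ge0$ and every vertex $(x,y)$, the neighborhood of $(x,y)$ in $G^{(t)}$ consists of exactly the following 4 vertices: if $t=2l$ is even, $(x\pm2^l\bmod S,\,y)$ and $(x,\,y\pm2^l\bmod S)$; if $t=2l+1$ is odd, $(x\pm2^l\bmod S,\,y\pm2^l\bmod S)$ (all four sign combinations).
   Context: $G_S$ is the graph on $\{0,\dots,S-1\}^2$ in which $(x,y)$ is adjacent to $(x,y\pm1\bmod S)$ and $(x\pm1\bmod S,y)$. Process: $G^{(t+1)}$ on the same vertex set is defined by: for each pair $\{u,v\}\in C^{(t)}$, it is an edge of $G^{(t+1)}$ iff $\mathcal{E}^{(t)}(u,v)\ge2$; pairs not in $C^{(t)}$ keep their status. -}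

module Defs where

open import Data.Nat using (ℕ; zero; suc; _+_; _∸_; _^_; _%_; _≤ᵇ_; NonZero)
open import Data.Nat.DivMod using (m%n<n)
open import Data.Fin using (Fin; toℕ; fromℕ<)
open import Data.Fin.Properties using () renaming (_≟_ to _≟ᶠ_)
open import Data.Product using (_×_; _,_)
open import Data.Product.Properties using (≡-dec)
open import Data.Bool using (Bool; true; false; _∧_; _∨_; not; if_then_else_)
open import Data.List using (List; []; _∷_; length; filterᵇ; map; concatMap; allFin)
open import Data.Bool.ListAction using (any)
open import Relation.Binary.PropositionalEquality using (_≡_)
open import Relation.Nullary using (does)
open import Relation.Binary.Definitions using (DecidableEquality)

V : ℕ → Set
V S = Fin S × Fin S

_≟V_ : ∀ {S} → DecidableEquality (V S)
_≟V_ = ≡-dec _≟ᶠ_ _≟ᶠ_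

-- A graph on V S, given by its (Boolean, symmetric-by-construction) adjacency relation.
Graph : ℕ → Set
Graph S = V S → V S → Bool

allV : (S : ℕ) → List (V S)
allV S = concatMap (λ x → map (λ y → (x , y)) (allFin S)) (allFin S)

_+ₘ_ : ∀ {S} .{{_ : NonZero S}} → Fin S → ℕ → Fin S
_+ₘ_ {S} x k = fromℕ< (m%n<n (toℕ x + k) S)

_-ₘ_ : ∀ {S} .{{_ : NonZero S}} → Fin S → ℕ → Fin S
_-ₘ_ {S} x k = x +ₘ (S ∸ (k % S))

torusNbrs : ∀ {S} .{{_ : NonZero S}} → V S → List (V S)
torusNbrs (x , y) = (x +ₘ 1 , y) ∷ (x -ₘ 1 , y) ∷ (x , y +ₘ 1) ∷ (x , y -ₘ 1) ∷ []

memb : ∀ {S} → V S → List (V S) → Bool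
memb v l = any (λ w → does (v ≟V w)) l

G₀ : ∀ S .{{_ : NonZero S}} → Graph S
G₀ S u v = memb v (torusNbrs u)

energy : ∀ {S} → Graph S → V S → V S → ℕ
energy {S} G u v = length (filterᵇ (λ w → G u w ∧ G v w) (allV S))

inC : ∀ {S} → Graph S → V S → V S → Bool
inC {S} G u v = not (does (u ≟V v)) ∧ (G u v ∨ any (λ w → G u w ∧ G w v) (allV S))

-- one step of the process with α = β = 2
step : ∀ {S} → Graph S → Graph S
step G u v = if inC G u v then 2 ≤ᵇ energy G u v else G u v

Gt : ∀ S .{{_ : NonZero S}} → ℕ → Graph S
Gt S zero = G₀ S
Gt S (suc t) = step (Gt S t)

evenNbrs : ∀ {S} .{{_ : NonZero S}} → ℕ → V S → List (V S)
evenNbrs l (x , y) =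
  (x +ₘ (2 ^ l) , y) ∷ (x -ₘ (2 ^ l) , y) ∷ (x , y +ₘ (2 ^ l)) ∷ (x , y -ₘ (2 ^ l)) ∷ []

oddNbrs : ∀ {S} .{{_ : NonZero S}} → ℕ → V S → List (V S)
oddNbrs l (x , y) =
  (x +ₘ (2 ^ l) , y +ₘ (2 ^ l)) ∷ (x +ₘ (2 ^ l) , y -ₘ (2 ^ l)) ∷
  (x -ₘ (2 ^ l) , y +ₘ (2 ^ l)) ∷ (x -ₘ (2 ^ l) , y -ₘ (2 ^ l)) ∷ []

module Submission where

-- Every graph in the process is a Cayley-type graph: u ~ w iff w = u + a·g for an
-- offset g from a fixed list Gen ⊆ ℤ², where a = 2ˡ.  For such a graph the step rule
-- is decided by finitely many relations between offsets ("is a·k ≡ 0 (mod S)" for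
-- |k| ≤ 4), so the theorem reduces to:
--   * residues modulo S and the translations u ↦ u + a·g of the torus;
--   * a Boolean zero test, exact for |k| ≤ 4, and the offset comparisons it yields;
--   * general facts about one step of the process (energy bounds, when an edge appears);
--   * the transition theorem: if G has offsets Gen and a finite check on (Gen, Gen′)
--     succeeds, then step G has offsets Gen′;
--   * for odd S the test "S ∣ k" is exact for a·k with a = 2ˡ; it is "3 ∣ k" for S = 3 and
--     "k = 0" for S ≥ 5, on which the finite checks are evaluated by normalisation.
-- The theorem follows by induction on l, alternating axes → diagonals → doubled axes.

open import Defs
open import Data.Nat using (ℕ; NonZero; _≤_; _%_; _*_; _+_)
open import Data.Bool using (true)
open import Data.Product using (_×_)
open import Data.List.Membership.Propositional using (_∈_)
open import Data.List.Relation.Unary.Unique.Propositional using (Unique)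
open import Relation.Binary.PropositionalEquality using (_≡_)
open import Function.Bundles using (_⇔_)

open import Data.Nat using (zero; suc; _<_; _^_; _∸_; _≤ᵇ_; _≡ᵇ_; _⊔_; z≤n; s≤s)
import Data.Nat.Properties as ℕₚ
open import Data.Nat.DivMod using (m≡m%n+[m/n]*n; m%n≤n; _/_)
open import Data.Nat.Divisibility using (_∣_; n∣m*n; ∣n⇒∣m*n; >⇒∤; m%n≡0⇒n∣m; n∣m⇒m%n≡0; _∣0)
open import Data.Nat.Coprimality using (Coprime; coprime-+; coprime-divisor; 1-coprimeTo)
open import Data.Integer using (ℤ; +_; -_; _-_; ∣_∣; _%ℕ_; _/ℕ_)
  renaming (_+_ to _+ᶻ_; _*_ to _*ᶻ_)
import Data.Integer.Properties as ℤₚ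
open import Data.Integer.DivMod using (n%ℕd<d; a≡a%ℕn+[a/ℕn]*n)
open import Data.Integer.Divisibility.Signed using (∣ᵤ⇒∣; ∣⇒∣ᵤ; ∣-refl; ∣m⇒∣-m; ∣m∣n⇒∣m+n)
  renaming (_∣_ to _∣ᶻ_; ∣n⇒∣m*n to ∣ᶻn⇒∣ᶻm*n)
open import Data.Integer.Tactic.RingSolver using (solve-∀)
open import Data.Fin using (Fin; toℕ; fromℕ<)
open import Data.Fin.Properties using (toℕ-fromℕ<; toℕ-injective; toℕ<n)
open import Data.Bool using (Bool; false; T; not; _∧_; _∨_; if_then_else_)
open import Data.Bool.Properties using (T-≡; T-∧; T-∨)
open import Data.Bool.ListAction using (all; any)
open import Data.Unit using (tt)
open import Data.Empty using (⊥-elim)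
open import Data.Product using (_,_; proj₁; proj₂; ∃-syntax; ∃₂)
open import Data.Sum using (_⊎_; inj₁; inj₂)
open import Data.List
  using (List; []; _∷_; length; map; filterᵇ; allFin; cartesianProduct; concatMap; _++_)
open import Data.List.Relation.Unary.Any using (here; there)
import Data.List.Relation.Unary.Any as Any
open import Data.List.Relation.Unary.All as All using (_∷_)
open import Data.List.Relation.Unary.Any.Properties using (any⁺; any⁻)
open import Data.List.Relation.Unary.All.Properties using (all⁺) renaming (map⁺ to All-map⁺)
open import Data.List.Relation.Unary.AllPairs using ([]; _∷_)
open import Data.List.Membership.Propositional using (_∉_; find; lose)
open import Data.List.Membership.Propositional.Properties
  using (∈-map⁺; ∈-map⁻; ∈-filter⁺; ∈-filter⁻; ∈-allFin; ∈-cartesianProduct⁺)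
import Data.List.Relation.Unary.Unique.Propositional.Properties as Uniqueₚ
open import Relation.Binary.PropositionalEquality
  using (_≢_; refl; sym; trans; cong; cong₂; subst; subst₂; module ≡-Reasoning)
open import Relation.Nullary using (¬_; Dec; yes; no; does)
open import Relation.Nullary.Decidable using (T?; dec-false)
open import Function using (_∘_)
open import Function.Bundles using (mk⇔; module Equivalence)
import Function.Properties.Equivalence as ⇔
open Equivalence using (to; from)

all-elim : ∀ {A : Set} (p : A → Bool) {xs x} → T (all p xs) → x ∈ xs → T (p x)
all-elim p {xs} holds x∈xs = All.lookup (all⁺ p xs holds) x∈xs

any-elim : ∀ {A : Set} (p : A → Bool) {xs} → T (any p xs) → ∃[ x ] x ∈ xs × T (p x)
any-elim p {xs} holds = find (any⁻ p xs holds)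

any-intro : ∀ {A : Set} (p : A → Bool) {xs x} → x ∈ xs → T (p x) → T (any p xs)
any-intro p x∈xs px = any⁺ p (lose x∈xs px)

T-does : ∀ {A : Set} (d : Dec A) → T (does d) ⇔ A
T-does (yes a) = mk⇔ (λ _ → a) (λ _ → tt)
T-does (no ¬a) = mk⇔ (λ ()) ¬a

T-not : ∀ {b} → T (not b) → ¬ T b
T-not {false} _ ()

T-if : ∀ {b x y} → T b → T x → T (if b then x else y)
T-if {true} _ tx = tx

memb-spec : ∀ {S} (v : V S) (vs : List (V S)) → T (memb v vs) ⇔ v ∈ vs
memb-spec v vs =
  mk⇔ (Any.map (λ {w} → to (T-does (v ≟V w))) ∘ any⁻ _ vs)
      (any⁺ _ ∘ Any.map (λ {w} → from (T-does (v ≟V w))))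

relist : ∀ {A P : Set} {x : A} {xs ys} → xs ≡ ys → P ⇔ x ∈ xs → P ⇔ x ∈ ys
relist refl P⇔x∈xs = P⇔x∈xs

length≥2 : ∀ {A : Set} {x y : A} (xs : List A) → x ≢ y → x ∈ xs → y ∈ xs → 2 ≤ length xs
length≥2 (_ ∷ []) x≢y (here refl) (here refl) = ⊥-elim (x≢y refl)
length≥2 (_ ∷ _ ∷ _) _ _ _ = s≤s (s≤s z≤n)

length≤1 : ∀ {A : Set} {xs : List A} → Unique xs → (∀ {x y} → x ∈ xs → y ∈ xs → x ≡ y) →
           length xs ≤ 1
length≤1 {xs = []} _ _ = z≤n
length≤1 {xs = _ ∷ []} _ _ = s≤s z≤n
length≤1 {xs = _ ∷ _ ∷ _} ((x≢y ∷ _) ∷ _) same = ⊥-elim (x≢y (same (here refl) (there (here refl))))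

concatMap-pairs : ∀ {A B : Set} (xs : List A) (ys : List B) →
  concatMap (λ x → map (λ y → (x , y)) ys) xs ≡ cartesianProduct xs ys
concatMap-pairs [] ys = refl
concatMap-pairs (x ∷ xs) ys = cong (map (x ,_) ys ++_) (concatMap-pairs xs ys)

∈-allV : ∀ {S} (v : V S) → v ∈ allV S
∈-allV {S} (x , y) =
  subst ((x , y) ∈_) (sym (concatMap-pairs (allFin S) (allFin S)))
    (∈-cartesianProduct⁺ (∈-allFin x) (∈-allFin y))

allV-unique : ∀ S → Unique (allV S)
allV-unique S =
  subst Unique (sym (concatMap-pairs (allFin S) (allFin S)))
    (Uniqueₚ.cartesianProduct⁺ (Uniqueₚ.allFin⁺ S) (Uniqueₚ.allFin⁺ S))

small-multiple : ∀ {S n} → S ∣ n → n < S → n ≡ 0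
small-multiple {n = zero} _ _ = refl
small-multiple {n = suc _} S∣n n<S = ⊥-elim (>⇒∤ n<S S∣n)

Offset : Set
Offset = ℤ × ℤ

infixl 8 _+ᵒ_ _-ᵒ_
infix 9 -ᵒ_

0ᵒ : Offset
0ᵒ = + 0 , + 0

_+ᵒ_ : Offset → Offset → Offset
(c , d) +ᵒ (c′ , d′) = c +ᶻ c′ , d +ᶻ d′

-ᵒ_ : Offset → Offset
-ᵒ (c , d) = - c , - d

_-ᵒ_ : Offset → Offset → Offset
g -ᵒ h = g +ᵒ -ᵒ h

+ᵒ-inverseʳ : ∀ g → g -ᵒ g ≡ 0ᵒ
+ᵒ-inverseʳ (c , d) = cong₂ _,_ (ℤₚ.+-inverseʳ c) (ℤₚ.+-inverseʳ d)

axes : ℕ → List Offset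
axes m = (+ m , + 0) ∷ (- + m , + 0) ∷ (+ 0 , + m) ∷ (+ 0 , - + m) ∷ []

diagonals : ℕ → List Offset
diagonals m = (+ m , + m) ∷ (+ m , - + m) ∷ (- + m , + m) ∷ (- + m , - + m) ∷ []

module Residues (S : ℕ) .{{_ : NonZero S}} where

  infix 4 _≋_
  infixl 6 _⊕_

  record _≋_ (p q : ℤ) : Set where
    constructor mod-S
    field S∣difference : + S ∣ᶻ p - q

  ≋-sym : ∀ {p q} → p ≋ q → q ≋ p
  ≋-sym {p} {q} (mod-S S∣p-q) = mod-S (subst (+ S ∣ᶻ_) (negated-difference p q) (∣m⇒∣-m S∣p-q))
    where
    negated-difference : ∀ p q → - (p - q) ≡ q - p
    negated-difference = solve-∀

  ≋-trans : ∀ {p q r} → p ≋ q → q ≋ r → p ≋ r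
  ≋-trans {p} {q} {r} (mod-S S∣p-q) (mod-S S∣q-r) =
    mod-S (subst (+ S ∣ᶻ_) (telescope p q r) (∣m∣n⇒∣m+n S∣p-q S∣q-r))
    where
    telescope : ∀ p q r → (p - q) +ᶻ (q - r) ≡ p - r
    telescope = solve-∀

  +-difference : ∀ x c d → (x +ᶻ c) - (x +ᶻ d) ≡ c - d
  +-difference = solve-∀

  ≋-+ʳ : ∀ {p q} d → p ≋ q → p +ᶻ d ≋ q +ᶻ d
  ≋-+ʳ {p} {q} d (mod-S S∣p-q) = mod-S (subst (+ S ∣ᶻ_) (sym (difference p q d)) S∣p-q)
    where
    difference : ∀ p q d → (p +ᶻ d) - (q +ᶻ d) ≡ p - q
    difference = solve-∀

  -- the least non-negative residue; kept abstract, so that only its value toℕ-residue is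
  -- used and its proof of boundedness is never unfolded
  abstract
    residue : ℤ → Fin S
    residue p = fromℕ< (n%ℕd<d p S)

    toℕ-residue : ∀ p → toℕ (residue p) ≡ p %ℕ S
    toℕ-residue p = toℕ-fromℕ< (n%ℕd<d p S)

  residue-≋ : ∀ p → + toℕ (residue p) ≋ p
  residue-≋ p =
    mod-S (subst (+ S ∣ᶻ_) (sym remainder-difference) (∣m⇒∣-m (∣ᶻn⇒∣ᶻm*n (p /ℕ S) ∣-refl)))
    where
    open ≡-Reasoning
    cancel : ∀ r q s → r - (r +ᶻ q *ᶻ s) ≡ - (q *ᶻ s)
    cancel = solve-∀
    remainder-difference : + toℕ (residue p) - p ≡ - (p /ℕ S *ᶻ + S)
    remainder-difference = begin
      + toℕ (residue p) - p                         ≡⟨ cong (λ r → + r - p) (toℕ-residue p) ⟩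
      + (p %ℕ S) - p                                ≡⟨ cong (λ q → + (p %ℕ S) - q) (a≡a%ℕn+[a/ℕn]*n p S) ⟩
      + (p %ℕ S) - (+ (p %ℕ S) +ᶻ p /ℕ S *ᶻ + S)   ≡⟨ cancel (+ (p %ℕ S)) (p /ℕ S) (+ S) ⟩
      - (p /ℕ S *ᶻ + S)                              ∎

  ≋-canonical : ∀ {r s} → r < S → s < S → + r ≋ + s → r ≡ s
  ≋-canonical {r} {s} r<S s<S (mod-S S∣r-s) =
    ℤₚ.+-injective (ℤₚ.i-j≡0⇒i≡j _ _ (ℤₚ.∣i∣≡0⇒i≡0 (small-multiple (∣⇒∣ᵤ S∣r-s) distance<S)))
    where
    distance<S : ∣ + r - + s ∣ < S
    distance<S = ℕₚ.≤-<-trans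
      (subst (_≤ r ⊔ s) (cong ∣_∣ (sym (ℤₚ.m-n≡m⊖n r s))) (ℤₚ.∣m⊝n∣≤m⊔n r s))
      (ℕₚ.⊔-lub r<S s<S)

  residue-cong : ∀ {p q} → p ≋ q → residue p ≡ residue q
  residue-cong {p} {q} p≋q = toℕ-injective (≋-canonical (toℕ<n _) (toℕ<n _)
    (≋-trans (residue-≋ p) (≋-trans p≋q (≋-sym (residue-≋ q)))))

  residue-injective : ∀ {p q} → residue p ≡ residue q → p ≋ q
  residue-injective {p} {q} eq =
    ≋-trans (≋-sym (residue-≋ p)) (subst (λ x → + toℕ x ≋ q) (sym eq) (residue-≋ q))

  residue-toℕ : ∀ x → residue (+ toℕ x) ≡ x
  residue-toℕ x = toℕ-injective (≋-canonical (toℕ<n _) (toℕ<n x) (residue-≋ (+ toℕ x)))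

  _⊕_ : Fin S → ℤ → Fin S
  x ⊕ c = residue (+ toℕ x +ᶻ c)

  ⊕-⊕ : ∀ x c d → x ⊕ c ⊕ d ≡ x ⊕ (c +ᶻ d)
  ⊕-⊕ x c d = residue-cong {+ toℕ (x ⊕ c) +ᶻ d} {+ toℕ x +ᶻ (c +ᶻ d)}
    (subst (+ toℕ (x ⊕ c) +ᶻ d ≋_) (ℤₚ.+-assoc (+ toℕ x) c d)
      (≋-+ʳ {+ toℕ (x ⊕ c)} {+ toℕ x +ᶻ c} d (residue-≋ (+ toℕ x +ᶻ c))))

  ⊕-identityʳ : ∀ x → x ⊕ + 0 ≡ x
  ⊕-identityʳ x = trans (cong residue (ℤₚ.+-identityʳ (+ toℕ x))) (residue-toℕ x)

  ⊕-cong : ∀ x {c d} → c ≋ d → x ⊕ c ≡ x ⊕ d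
  ⊕-cong x {c} {d} (mod-S S∣c-d) =
    residue-cong {+ toℕ x +ᶻ c} {+ toℕ x +ᶻ d}
      (mod-S (subst (+ S ∣ᶻ_) (sym (+-difference (+ toℕ x) c d)) S∣c-d))

  ⊕-injective : ∀ x {c d} → x ⊕ c ≡ x ⊕ d → c ≋ d
  ⊕-injective x {c} {d} eq with residue-injective {+ toℕ x +ᶻ c} {+ toℕ x +ᶻ d} eq
  ... | mod-S S∣difference = mod-S (subst (+ S ∣ᶻ_) (+-difference (+ toℕ x) c d) S∣difference)

  +ₘ-⊕ : ∀ x m → x +ₘ m ≡ x ⊕ + m
  +ₘ-⊕ x m = trans (toℕ-injective (trans (toℕ-fromℕ< _) (sym (toℕ-residue (+ (toℕ x + m))))))
                   (cong residue (ℤₚ.pos-+ (toℕ x) m))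

  -ₘ-⊕ : ∀ x m → x -ₘ m ≡ x ⊕ - + m
  -ₘ-⊕ x m = trans (+ₘ-⊕ x k) (⊕-cong x k≋-m)
    where
    open ≡-Reasoning
    k = S ∸ m % S
    k+m≡multiple : k + m ≡ suc (m / S) * S
    k+m≡multiple = begin
      k + m                           ≡⟨ cong (λ n → k + n) (m≡m%n+[m/n]*n m S) ⟩
      k + (m % S + m / S * S)         ≡⟨ ℕₚ.+-assoc k (m % S) _ ⟨
      (k + m % S) + m / S * S         ≡⟨ cong (_+ m / S * S) (ℕₚ.m∸n+n≡m (m%n≤n m S)) ⟩
      S + m / S * S                   ∎
    k≋-m : + k ≋ - + m
    k≋-m = mod-S (subst (+ S ∣ᶻ_)
      (trans (ℤₚ.pos-+ k m) (cong (+ k +ᶻ_) (sym (ℤₚ.neg-involutive (+ m)))))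
      (∣ᵤ⇒∣ (subst (S ∣_) (sym k+m≡multiple) (n∣m*n (suc (m / S))))))

module Translations (S : ℕ) .{{_ : NonZero S}} (a : ℕ) where
  open Residues S

  *-distribˡ-difference : ∀ a c d → a *ᶻ c - a *ᶻ d ≡ a *ᶻ (c - d)
  *-distribˡ-difference = solve-∀

  scaled-cong : ∀ x {c d} → + S ∣ᶻ + a *ᶻ (c - d) → x ⊕ + a *ᶻ c ≡ x ⊕ + a *ᶻ d
  scaled-cong x {c} {d} S∣a[c-d] = ⊕-cong x {+ a *ᶻ c} {+ a *ᶻ d}
    (mod-S (subst (+ S ∣ᶻ_) (sym (*-distribˡ-difference (+ a) c d)) S∣a[c-d]))

  scaled-injective : ∀ x {c d} → x ⊕ + a *ᶻ c ≡ x ⊕ + a *ᶻ d → + S ∣ᶻ + a *ᶻ (c - d)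
  scaled-injective x {c} {d} eq with ⊕-injective x {+ a *ᶻ c} {+ a *ᶻ d} eq
  ... | mod-S S∣difference = subst (+ S ∣ᶻ_) (*-distribˡ-difference (+ a) c d) S∣difference

  ⊕-scaled-zero : ∀ x → x ⊕ + a *ᶻ + 0 ≡ x
  ⊕-scaled-zero x = trans (cong (x ⊕_) (ℤₚ.*-zeroʳ (+ a))) (⊕-identityʳ x)

  +ₘ-scaled : ∀ {m n} → a * m ≡ n → ∀ x → x +ₘ n ≡ x ⊕ + a *ᶻ + m
  +ₘ-scaled {m} {n} am≡n x =
    trans (+ₘ-⊕ x n) (cong (x ⊕_) (trans (cong +_ (sym am≡n)) (ℤₚ.pos-* a m)))

  -ₘ-scaled : ∀ {m n} → a * m ≡ n → ∀ x → x -ₘ n ≡ x ⊕ + a *ᶻ - + m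
  -ₘ-scaled {m} {n} am≡n x = trans (-ₘ-⊕ x n) (cong (x ⊕_) (begin
    - + n            ≡⟨ cong (λ k → - + k) am≡n ⟨
    - + (a * m)      ≡⟨ cong -_ (ℤₚ.pos-* a m) ⟩
    - (+ a *ᶻ + m)   ≡⟨ ℤₚ.neg-distribʳ-* (+ a) (+ m) ⟩
    + a *ᶻ - + m     ∎))
    where open ≡-Reasoning

  -- The translation u ↦ u + a·g.  It is opaque: elsewhere only the properties proved in this
  -- block are used, so the residues in its definition are never unfolded.
  opaque
    translate : V S → Offset → V S
    translate (x , y) (c , d) = x ⊕ + a *ᶻ c , y ⊕ + a *ᶻ d

    translate-+ᵒ : ∀ u g h → translate (translate u g) h ≡ translate u (g +ᵒ h)
    translate-+ᵒ (x , y) (c , d) (c′ , d′) = cong₂ _,_ (shift x c c′) (shift y d d′)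
      where
      shift : ∀ x c c′ → x ⊕ + a *ᶻ c ⊕ + a *ᶻ c′ ≡ x ⊕ + a *ᶻ (c +ᶻ c′)
      shift x c c′ =
        trans (⊕-⊕ x (+ a *ᶻ c) (+ a *ᶻ c′)) (cong (x ⊕_) (sym (ℤₚ.*-distribˡ-+ (+ a) c c′)))

    translate-0ᵒ : ∀ u → translate u 0ᵒ ≡ u
    translate-0ᵒ (x , y) = cong₂ _,_ (⊕-scaled-zero x) (⊕-scaled-zero y)

    translate-cong : ∀ u {g h} → + S ∣ᶻ + a *ᶻ (proj₁ g - proj₁ h) → + S ∣ᶻ + a *ᶻ (proj₂ g - proj₂ h) →
                     translate u g ≡ translate u h
    translate-cong (x , y) first second = cong₂ _,_ (scaled-cong x first) (scaled-cong y second)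

    translate-injective : ∀ u {g h} → translate u g ≡ translate u h →
      + S ∣ᶻ + a *ᶻ (proj₁ g - proj₁ h) × + S ∣ᶻ + a *ᶻ (proj₂ g - proj₂ h)
    translate-injective (x , y) eq =
      scaled-injective x (cong proj₁ eq) , scaled-injective y (cong proj₂ eq)

    evenNbrs-axes : ∀ {l m} → a * m ≡ 2 ^ l → ∀ u → evenNbrs l u ≡ map (translate u) (axes m)
    evenNbrs-axes {l} {m} am≡2ˡ (x , y) =
      cong₂ _∷_ (cong₂ _,_ (plus x) (stay y)) (cong₂ _∷_ (cong₂ _,_ (minus x) (stay y))
        (cong₂ _∷_ (cong₂ _,_ (stay x) (plus y)) (cong₂ _∷_ (cong₂ _,_ (stay x) (minus y)) refl)))
      where
      plus : ∀ z → z +ₘ (2 ^ l) ≡ z ⊕ + a *ᶻ + m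
      plus = +ₘ-scaled am≡2ˡ
      minus : ∀ z → z -ₘ (2 ^ l) ≡ z ⊕ + a *ᶻ - + m
      minus = -ₘ-scaled am≡2ˡ
      stay : ∀ z → z ≡ z ⊕ + a *ᶻ + 0
      stay z = sym (⊕-scaled-zero z)

    oddNbrs-diagonals : ∀ {l m} → a * m ≡ 2 ^ l → ∀ u → oddNbrs l u ≡ map (translate u) (diagonals m)
    oddNbrs-diagonals {l} {m} am≡2ˡ (x , y) =
      cong₂ _∷_ (cong₂ _,_ (plus x) (plus y)) (cong₂ _∷_ (cong₂ _,_ (plus x) (minus y))
        (cong₂ _∷_ (cong₂ _,_ (minus x) (plus y)) (cong₂ _∷_ (cong₂ _,_ (minus x) (minus y)) refl)))
      where
      plus : ∀ z → z +ₘ (2 ^ l) ≡ z ⊕ + a *ᶻ + m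
      plus = +ₘ-scaled am≡2ˡ
      minus : ∀ z → z -ₘ (2 ^ l) ≡ z ⊕ + a *ᶻ - + m
      minus = -ₘ-scaled am≡2ˡ

  translate-back : ∀ u g → translate (translate u g) (-ᵒ g) ≡ u
  translate-back u g =
    trans (translate-+ᵒ u g (-ᵒ g)) (trans (cong (translate u) (+ᵒ-inverseʳ g)) (translate-0ᵒ u))

-- Boolean comparisons of offsets, relative to a test `isZero k` for "S ∣ a·k", and the
-- finite conditions of the transition theorem for old offsets Gen and new offsets Gen′.
module OffsetChecks (isZero : ℤ → Bool) where

  infix 7 _≈ᵇ_ _≉ᵇ_

  _≈ᵇ_ : Offset → Offset → Bool
  (c , d) ≈ᵇ (c′ , d′) = isZero (c - c′) ∧ isZero (d - d′)

  -- k is small and not a zero; the test is trusted to detect zeros only for |k| ≤ 4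
  nonzeroᵇ : ℤ → Bool
  nonzeroᵇ k = (∣ k ∣ ≤ᵇ 4) ∧ not (isZero k)

  _≉ᵇ_ : Offset → Offset → Bool
  (c , d) ≉ᵇ (c′ , d′) = nonzeroᵇ (c - c′) ∨ nonzeroᵇ (d - d′)

  distinct : List Offset → Bool
  distinct [] = true
  distinct (g ∷ gs) = all (g ≉ᵇ_) gs ∧ distinct gs

  nonzero : List Offset → Bool
  nonzero = all (_≉ᵇ 0ᵒ)

  -- two different common neighbours u + g₁, u + g₂ of u and v = u + g₁ - g₁′ = u + g₂ - g₂′
  -- only occur when v = u or v is a new neighbour
  fewCommonAt : List Offset → Offset → Offset → Offset → Offset → Bool
  fewCommonAt Gen′ g₁ g₁′ g₂ g₂′ =
    g₁ ≈ᵇ g₂ ∨ g₁ -ᵒ g₁′ ≉ᵇ g₂ -ᵒ g₂′ ∨ g₁ -ᵒ g₁′ ≈ᵇ 0ᵒ ∨ any (g₁ -ᵒ g₁′ ≈ᵇ_) Gen′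

  fewCommon : List Offset → List Offset → Bool
  fewCommon Gen Gen′ =
    all (λ g₁ → all (λ g₁′ → all (λ g₂ → all (fewCommonAt Gen′ g₁ g₁′ g₂) Gen) Gen) Gen) Gen

  -- the new neighbour v = u + g″ has the two different common neighbours
  -- u + g₁ = v + h₁ and u + g₂ = v + h₂ with u
  twoCommonVia : Offset → Offset → Offset → Offset → Offset → Bool
  twoCommonVia g″ g₁ h₁ g₂ h₂ = g″ +ᵒ h₁ ≈ᵇ g₁ ∧ g″ +ᵒ h₂ ≈ᵇ g₂ ∧ g₁ ≉ᵇ g₂

  manyCommon : List Offset → List Offset → Bool
  manyCommon Gen Gen′ =
    all (λ g″ → any (λ g₁ → any (λ h₁ → any (λ g₂ →
      any (twoCommonVia g″ g₁ h₁ g₂) Gen) Gen) Gen) Gen) Gen′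

  withinTwo : List Offset → List Offset → Bool
  withinTwo Gen Gen′ = all (λ g″ → any (λ g → any (λ h → g +ᵒ h ≈ᵇ g″) Gen) Gen) Gen′

  record TransitionConditions (Gen Gen′ : List Offset) : Set where
    field
      loop-free-old : T (nonzero Gen)
      loop-free-new : T (nonzero Gen′)
      few-common    : T (fewCommon Gen Gen′)
      many-common   : T (manyCommon Gen Gen′)
      within-two    : T (withinTwo Gen Gen′)

record ZeroTest (S a : ℕ) (isZero : ℤ → Bool) : Set where
  field
    sound    : ∀ k → T (isZero k) → + S ∣ᶻ + a *ᶻ k
    complete : ∀ k → ∣ k ∣ ≤ 4 → + S ∣ᶻ + a *ᶻ k → T (isZero k)

module SoundComparisons {S a : ℕ} {isZero : ℤ → Bool} .{{_ : NonZero S}} (test : ZeroTest S a isZero)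
  where
  open Translations S a
  open OffsetChecks isZero
  open ZeroTest test

  ≈ᵇ-sound : ∀ u {g h} → T (g ≈ᵇ h) → translate u g ≡ translate u h
  ≈ᵇ-sound u {c , d} {c′ , d′} same with to T-∧ same
  ... | first , second = translate-cong u (sound _ first) (sound _ second)

  nonzeroᵇ-sound : ∀ {k} → T (nonzeroᵇ k) → ¬ (+ S ∣ᶻ + a *ᶻ k)
  nonzeroᵇ-sound {k} differ S∣ak with to T-∧ differ
  ... | small , notZero = T-not notZero (complete k (ℕₚ.≤ᵇ⇒≤ _ _ small) S∣ak)

  ≉ᵇ-sound : ∀ u {g h} → T (g ≉ᵇ h) → translate u g ≢ translate u h
  ≉ᵇ-sound u {c , d} {c′ , d′} differ eq with to T-∨ differ | translate-injective u eq
  ... | inj₁ first | S∣first , _ = nonzeroᵇ-sound first S∣first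
  ... | inj₂ second | _ , S∣second = nonzeroᵇ-sound second S∣second

  distinct-sound : ∀ u gs → T (distinct gs) → Unique (map (translate u) gs)
  distinct-sound u [] _ = []
  distinct-sound u (g ∷ gs) differ with to T-∧ differ
  ... | new , rest = All-map⁺ (All.map (≉ᵇ-sound u) (all⁺ _ gs new)) ∷ distinct-sound u gs rest

module StepRule {S : ℕ} (G : Graph S) where

  common : V S → V S → V S → Bool
  common u v w = G u w ∧ G v w

  energy≥2 : ∀ {u v w₁ w₂} → w₁ ≢ w₂ → T (common u v w₁) → T (common u v w₂) → 2 ≤ energy G u v
  energy≥2 {u} {v} w₁≢w₂ c₁ c₂ = length≥2 _ w₁≢w₂
    (∈-filter⁺ (T? ∘ common u v) (∈-allV _) c₁) (∈-filter⁺ (T? ∘ common u v) (∈-allV _) c₂)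

  energy≤1 : ∀ {u v} → (∀ {w₁ w₂} → T (common u v w₁) → T (common u v w₂) → w₁ ≡ w₂) →
             energy G u v ≤ 1
  energy≤1 {u} {v} same =
    length≤1 (Uniqueₚ.filter⁺ (T? ∘ common u v) (allV-unique S))
             (λ m₁ m₂ → same (counted m₁) (counted m₂))
    where
    counted : ∀ {w} → w ∈ filterᵇ (common u v) (allV S) → T (common u v w)
    counted = proj₂ ∘ ∈-filter⁻ (T? ∘ common u v) {xs = allV S}

  step-intro : ∀ {u v w} → u ≢ v → T (G u w) → T (G w v) → 2 ≤ energy G u v → T (step G u v)
  step-intro {u} {v} {w} u≢v uw wv two = T-if interacting (ℕₚ.≤⇒≤ᵇ two)
    where
    interacting : T (inC G u v)
    interacting = from T-∧
      ( subst (T ∘ not) (sym (dec-false (u ≟V v) u≢v)) tt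
      , from T-∨ (inj₂ (any-intro (λ w → G u w ∧ G w v) (∈-allV w) (from T-∧ (uw , wv)))))

  -- an edge after the step is a loop kept from before, or joins distinct vertices with two
  -- common neighbours: an old edge joins an interacting pair, so its fate is decided by the energy
  step-elim : ∀ {u v} → T (step G u v) → (u ≡ v × T (G u u)) ⊎ (u ≢ v × 2 ≤ energy G u v)
  step-elim {u} {v} edge with u ≟V v
  ... | yes refl = inj₁ (refl , edge)
  ... | no u≢v = inj₂ (u≢v , ℕₚ.≤ᵇ⇒≤ 2 _ (decided-by-energy (G u v) _ edge))
    where
    decided-by-energy : ∀ b c {x} → T (if b ∨ c then x else b) → T x
    decided-by-energy true _ t = t
    decided-by-energy false true t = t

module Transition {S a : ℕ} {isZero : ℤ → Bool} .{{_ : NonZero S}} (test : ZeroTest S a isZero)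
  (G : Graph S) (Gen Gen′ : List Offset)
  (neighbours : ∀ u w → T (G u w) ⇔ w ∈ map (Translations.translate S a u) Gen)
  (conditions : OffsetChecks.TransitionConditions isZero Gen Gen′)
  where

  open Translations S a
  open OffsetChecks isZero
  open TransitionConditions conditions
  open SoundComparisons test
  open StepRule G
  open import Data.List.Membership.DecPropositional (_≟V_ {S}) using (_∈?_)

  neighbour-offset : ∀ {u w} → T (G u w) → ∃[ g ] g ∈ Gen × w ≡ translate u g
  neighbour-offset {u} {w} = ∈-map⁻ (translate u) ∘ to (neighbours u w)

  offset-neighbour : ∀ u {g} → g ∈ Gen → T (G u (translate u g))
  offset-neighbour u g∈Gen = from (neighbours u _) (∈-map⁺ (translate u) g∈Gen)

  moves : ∀ {gs} → T (nonzero gs) → ∀ u {g} → g ∈ gs → translate u g ≢ u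
  moves nz u g∈gs eq = ≉ᵇ-sound u (all-elim (_≉ᵇ 0ᵒ) nz g∈gs) (trans eq (sym (translate-0ᵒ u)))

  loop-free : ∀ u → ¬ T (G u u)
  loop-free u uu with neighbour-offset uu
  ... | g , g∈Gen , u≡u+g = moves loop-free-old u g∈Gen (sym u≡u+g)

  common-offsets : ∀ {u v w} → T (common u v w) →
    ∃₂ λ g g′ → g ∈ Gen × g′ ∈ Gen × w ≡ translate u g × v ≡ translate u (g -ᵒ g′)
  common-offsets {u} {v} {w} uvw with to T-∧ uvw
  ... | uw , vw with neighbour-offset uw | neighbour-offset vw
  ... | g , g∈Gen , w≡u+g | g′ , g′∈Gen , w≡v+g′ = g , g′ , g∈Gen , g′∈Gen , w≡u+g , (begin
    v                                   ≡⟨ translate-back v g′ ⟨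
    translate (translate v g′) (-ᵒ g′)  ≡⟨ cong (λ z → translate z (-ᵒ g′)) (trans (sym w≡v+g′) w≡u+g) ⟩
    translate (translate u g) (-ᵒ g′)   ≡⟨ translate-+ᵒ u g (-ᵒ g′) ⟩
    translate u (g -ᵒ g′)               ∎)
    where open ≡-Reasoning

  few-common-at : ∀ {g₁ g₁′ g₂ g₂′} → g₁ ∈ Gen → g₁′ ∈ Gen → g₂ ∈ Gen → g₂′ ∈ Gen →
                  T (fewCommonAt Gen′ g₁ g₁′ g₂ g₂′)
  few-common-at {g₁} {g₁′} {g₂} g₁∈ g₁′∈ g₂∈ g₂′∈ =
    all-elim (fewCommonAt Gen′ g₁ g₁′ g₂) (all-elim (λ g₂ → all (fewCommonAt Gen′ g₁ g₁′ g₂) Gen)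
      (all-elim (λ g₁′ → all (λ g₂ → all (fewCommonAt Gen′ g₁ g₁′ g₂) Gen) Gen)
        (all-elim (λ g₁ → all (λ g₁′ → all (λ g₂ → all (fewCommonAt Gen′ g₁ g₁′ g₂) Gen) Gen) Gen)
          few-common g₁∈) g₁′∈) g₂∈) g₂′∈

  few-common-cases : ∀ u g₁ g₁′ g₂ g₂′ → T (fewCommonAt Gen′ g₁ g₁′ g₂ g₂′) →
      translate u g₁ ≡ translate u g₂
    ⊎ translate u (g₁ -ᵒ g₁′) ≢ translate u (g₂ -ᵒ g₂′)
    ⊎ translate u (g₁ -ᵒ g₁′) ≡ u
    ⊎ translate u (g₁ -ᵒ g₁′) ∈ map (translate u) Gen′
  few-common-cases u g₁ g₁′ g₂ g₂′ holds with to T-∨ holds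
  ... | inj₁ g₁≈g₂ = inj₁ (≈ᵇ-sound u {g₁} {g₂} g₁≈g₂)
  ... | inj₂ rest with to T-∨ rest
  ... | inj₁ differ = inj₂ (inj₁ (≉ᵇ-sound u {g₁ -ᵒ g₁′} {g₂ -ᵒ g₂′} differ))
  ... | inj₂ rest′ with to T-∨ rest′
  ... | inj₁ ≈0 = inj₂ (inj₂ (inj₁ (trans (≈ᵇ-sound u {g₁ -ᵒ g₁′} {0ᵒ} ≈0) (translate-0ᵒ u))))
  ... | inj₂ ≈new with any-elim (g₁ -ᵒ g₁′ ≈ᵇ_) {Gen′} ≈new
  ... | g″ , g″∈ , ≈g″ = inj₂ (inj₂ (inj₂ (subst (_∈ map (translate u) Gen′)
          (sym (≈ᵇ-sound u {g₁ -ᵒ g₁′} {g″} ≈g″)) (∈-map⁺ (translate u) g″∈))))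

  unique-common : ∀ {u v} → v ∉ map (translate u) Gen′ → u ≢ v →
    ∀ {w₁ w₂} → T (common u v w₁) → T (common u v w₂) → w₁ ≡ w₂
  unique-common {u} {v} v∉new u≢v c₁ c₂ with common-offsets c₁ | common-offsets c₂
  ... | g₁ , g₁′ , g₁∈ , g₁′∈ , refl , refl | g₂ , g₂′ , g₂∈ , g₂′∈ , refl , v≡u+g₂-g₂′
    with few-common-cases u g₁ g₁′ g₂ g₂′ (few-common-at g₁∈ g₁′∈ g₂∈ g₂′∈)
  ... | inj₁ same = same
  ... | inj₂ (inj₁ differ) = ⊥-elim (differ v≡u+g₂-g₂′)
  ... | inj₂ (inj₂ (inj₁ v≡u)) = ⊥-elim (u≢v (sym v≡u))
  ... | inj₂ (inj₂ (inj₂ v∈new)) = ⊥-elim (v∉new v∈new)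

  adjacent-via : ∀ u {g h g″} → h ∈ Gen → T (g +ᵒ h ≈ᵇ g″) → T (G (translate u g) (translate u g″))
  adjacent-via u {g} {h} h∈Gen g+h≈g″ = subst (T ∘ G (translate u g))
    (trans (translate-+ᵒ u g h) (≈ᵇ-sound u g+h≈g″)) (offset-neighbour (translate u g) h∈Gen)

  new-energy : ∀ u {g″} → g″ ∈ Gen′ → 2 ≤ energy G u (translate u g″)
  new-energy u {g″} g″∈ with any-elim _ (all-elim _ many-common g″∈)
  ... | g₁ , g₁∈ , t₁ with any-elim _ t₁
  ... | h₁ , h₁∈ , t₂ with any-elim _ t₂
  ... | g₂ , g₂∈ , t₃ with any-elim _ t₃
  ... | h₂ , h₂∈ , t₄ with to T-∧ t₄
  ... | g″+h₁≈g₁ , t₅ with to T-∧ t₅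
  ... | g″+h₂≈g₂ , g₁≉g₂ = energy≥2 (≉ᵇ-sound u g₁≉g₂)
    (from T-∧ (offset-neighbour u g₁∈ , adjacent-via u h₁∈ g″+h₁≈g₁))
    (from T-∧ (offset-neighbour u g₂∈ , adjacent-via u h₂∈ g″+h₂≈g₂))

  new-path : ∀ u {g″} → g″ ∈ Gen′ → ∃[ w ] T (G u w) × T (G w (translate u g″))
  new-path u {g″} g″∈ with any-elim _ (all-elim _ within-two g″∈)
  ... | g , g∈Gen , t with any-elim _ t
  ... | h , h∈Gen , g+h≈g″ = translate u g , offset-neighbour u g∈Gen , adjacent-via u h∈Gen g+h≈g″

  new-edge : ∀ u {g″} → g″ ∈ Gen′ → T (step G u (translate u g″))
  new-edge u g″∈ with new-path u g″∈
  ... | w , uw , wv = step-intro (moves loop-free-new u g″∈ ∘ sym) uw wv (new-energy u g″∈)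

  -- conversely an edge of step G to a vertex w that is not new would need two common
  -- neighbours of u and w ≠ u, which fewCommon excludes
  step-neighbours : ∀ u w → T (step G u w) ⇔ w ∈ map (translate u) Gen′
  step-neighbours u w = mk⇔ edge⇒new new⇒edge
    where
    new⇒edge : w ∈ map (translate u) Gen′ → T (step G u w)
    new⇒edge w∈new with ∈-map⁻ (translate u) w∈new
    ... | g″ , g″∈ , w≡u+g″ = subst (T ∘ step G u) (sym w≡u+g″) (new-edge u g″∈)

    edge⇒new : T (step G u w) → w ∈ map (translate u) Gen′
    edge⇒new edge with step-elim edge
    ... | inj₁ (refl , loop) = ⊥-elim (loop-free u loop)
    ... | inj₂ (u≢w , two) with w ∈? map (translate u) Gen′
    ... | yes w∈new = w∈new
    ... | no w∉new = ⊥-elim (ℕₚ.≤⇒≯ (energy≤1 (unique-common w∉new u≢w)) two)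

odd-coprime-2 : ∀ k → Coprime (1 + k * 2) 2
odd-coprime-2 zero = 1-coprimeTo 2
odd-coprime-2 (suc k) = coprime-+ (odd-coprime-2 k)

odd⇒coprime-2 : ∀ {S} → S % 2 ≡ 1 → Coprime S 2
odd⇒coprime-2 {S} odd = subst (λ s → Coprime s 2) (sym S≡1+[S/2]*2) (odd-coprime-2 (S / 2))
  where
  S≡1+[S/2]*2 : S ≡ 1 + S / 2 * 2
  S≡1+[S/2]*2 = trans (m≡m%n+[m/n]*n S 2) (cong (_+ S / 2 * 2) odd)

odd-∣-2^* : ∀ {S} → S % 2 ≡ 1 → ∀ l n → S ∣ 2 ^ l * n → S ∣ n
odd-∣-2^* {S} odd zero n S∣n = subst (S ∣_) (ℕₚ.+-identityʳ n) S∣n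
odd-∣-2^* {S} odd (suc l) n S∣2ˡ⁺¹n = odd-∣-2^* odd l n
  (coprime-divisor (odd⇒coprime-2 odd) (subst (S ∣_) (ℕₚ.*-assoc 2 (2 ^ l) n) S∣2ˡ⁺¹n))

odd-zeroTest : ∀ {S isZero} → S % 2 ≡ 1 →
  (∀ k → T (isZero k) → S ∣ ∣ k ∣) → (∀ k → ∣ k ∣ ≤ 4 → S ∣ ∣ k ∣ → T (isZero k)) →
  ∀ l → ZeroTest S (2 ^ l) isZero
odd-zeroTest {S} odd sound complete l = record
  { sound = λ k t → ∣ᵤ⇒∣ (subst (S ∣_) (sym (ℤₚ.abs-* (+ (2 ^ l)) k)) (∣n⇒∣m*n (2 ^ l) (sound k t)))
  ; complete = λ k small S∣2ˡk →
      complete k small (odd-∣-2^* odd l ∣ k ∣ (subst (S ∣_) (ℤₚ.abs-* (+ (2 ^ l)) k) (∣⇒∣ᵤ S∣2ˡk)))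
  }

-- The two zero tests: among |k| ≤ 4, the modulus 3 divides the multiples of 3,
-- and a modulus S ≥ 5 divides only 0.
multipleOf3 : ℤ → Bool
multipleOf3 k = ∣ k ∣ % 3 ≡ᵇ 0

isZeroℤ : ℤ → Bool
isZeroℤ k = ∣ k ∣ ≡ᵇ 0

zeroTest-3 : ∀ l → ZeroTest 3 (2 ^ l) multipleOf3
zeroTest-3 = odd-zeroTest refl
  (λ k t → m%n≡0⇒n∣m ∣ k ∣ 3 (ℕₚ.≡ᵇ⇒≡ _ 0 t))
  (λ k _ 3∣k → ℕₚ.≡⇒≡ᵇ _ 0 (n∣m⇒m%n≡0 ∣ k ∣ 3 3∣k))

zeroTest-≥5 : ∀ {S} → 5 ≤ S → S % 2 ≡ 1 → ∀ l → ZeroTest S (2 ^ l) isZeroℤ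
zeroTest-≥5 {S} 5≤S odd = odd-zeroTest odd
  (λ k t → subst (S ∣_) (sym (ℕₚ.≡ᵇ⇒≡ ∣ k ∣ 0 t)) (S ∣0))
  (λ k small S∣k → ℕₚ.≡⇒≡ᵇ _ 0 (small-multiple S∣k (ℕₚ.≤-<-trans small 5≤S)))

module Evolution (S : ℕ) .{{_ : NonZero S}} {isZero : ℤ → Bool}
  (test : ∀ l → ZeroTest S (2 ^ l) isZero)
  (axes-distinct : T (OffsetChecks.distinct isZero (axes 1)))
  (diagonals-distinct : T (OffsetChecks.distinct isZero (diagonals 1)))
  (axes→diagonals : OffsetChecks.TransitionConditions isZero (axes 1) (diagonals 1))
  (diagonals→axes : OffsetChecks.TransitionConditions isZero (diagonals 1) (axes 2))
  where

  module Scale (l : ℕ) = Translations S (2 ^ l)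
  open Scale using (translate)

  even-translates : ∀ l u → evenNbrs l u ≡ map (translate l u) (axes 1)
  even-translates l = Scale.evenNbrs-axes l {l} (ℕₚ.*-identityʳ (2 ^ l))

  odd-translates : ∀ l u → oddNbrs l u ≡ map (translate l u) (diagonals 1)
  odd-translates l = Scale.oddNbrs-diagonals l {l} (ℕₚ.*-identityʳ (2 ^ l))

  even-suc-translates : ∀ l u → evenNbrs (suc l) u ≡ map (translate l u) (axes 2)
  even-suc-translates l = Scale.evenNbrs-axes l {suc l} (ℕₚ.*-comm (2 ^ l) 2)

  even-neighbours : ∀ l u w → T (Gt S (2 * l) u w) ⇔ w ∈ evenNbrs l u
  odd-neighbours : ∀ l u w → T (Gt S (1 + 2 * l) u w) ⇔ w ∈ oddNbrs l u

  even-neighbours zero u w = memb-spec w (torusNbrs u)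
  even-neighbours (suc l) u w =
    subst₂ (λ G ns → T (G u w) ⇔ w ∈ ns)
      (cong (Gt S) (sym (ℕₚ.*-suc 2 l))) (sym (even-suc-translates l u))
      (Transition.step-neighbours (test l) (Gt S (1 + 2 * l)) (diagonals 1) (axes 2)
        (λ v w → relist (odd-translates l v) (odd-neighbours l v w)) diagonals→axes u w)

  odd-neighbours l u w =
    relist (sym (odd-translates l u))
      (Transition.step-neighbours (test l) (Gt S (2 * l)) (axes 1) (diagonals 1)
        (λ v w → relist (even-translates l v) (even-neighbours l v w)) axes→diagonals u w)

  neighbourhoods : (l : ℕ) (u : V S) →
      (Unique (evenNbrs l u) × ((w : V S) → (Gt S (2 * l) u w ≡ true) ⇔ (w ∈ evenNbrs l u)))
      × (Unique (oddNbrs l u) × ((w : V S) → (Gt S (1 + 2 * l) u w ≡ true) ⇔ (w ∈ oddNbrs l u)))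
  neighbourhoods l u =
    ( subst Unique (sym (even-translates l u)) (distinct-sound u (axes 1) axes-distinct)
    , λ w → ⇔.trans (⇔.sym T-≡) (even-neighbours l u w) )
    , ( subst Unique (sym (odd-translates l u)) (distinct-sound u (diagonals 1) diagonals-distinct)
      , λ w → ⇔.trans (⇔.sym T-≡) (odd-neighbours l u w) )
    where open SoundComparisons (test l)

odd≥3 : ∀ {S} → 3 ≤ S → S % 2 ≡ 1 → S ≡ 3 ⊎ 5 ≤ S
odd≥3 {1} (s≤s ()) _
odd≥3 {3} _ _ = inj₁ refl
odd≥3 {suc (suc (suc (suc (suc _))))} _ _ = inj₂ (s≤s (s≤s (s≤s (s≤s (s≤s z≤n)))))

-- The neighbourhoods of the process.  For S = 3 and for S ≥ 5 the finite conditions evaluate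
-- to true, so their proofs tt (and the records of them) are found by the typechecker.
lemma8 : (S : ℕ) .{{_ : NonZero S}} → 3 ≤ S → S % 2 ≡ 1 →
    (l : ℕ) (u : V S) →
      (Unique (evenNbrs l u) × ((w : V S) → (Gt S (2 * l) u w ≡ true) ⇔ (w ∈ evenNbrs l u)))
      × (Unique (oddNbrs l u) × ((w : V S) → (Gt S (1 + 2 * l) u w ≡ true) ⇔ (w ∈ oddNbrs l u)))
lemma8 S 3≤S odd with odd≥3 3≤S odd
... | inj₁ refl = Evolution.neighbourhoods 3 zeroTest-3 tt tt _ _
... | inj₂ 5≤S = Evolution.neighbourhoods S (zeroTest-≥5 5≤S odd) tt tt _ _
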